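{- Define the following four sequences. (a) Let $P_1$ be the morphism of the free monoid on $\{\mathtt R,\mathtt r,\mathtt L,\mathtt l,\mathtt S,\mathtt s\}$ given by $\mathtt R\mapsto \mathtt{Rr}$, $\mathtt r\mapsto \mathtt S$, $\mathtt L\mapsto \mathtt S$, $\mathtt l\mapsto \mathtt{Ll}$, $\mathtt S\mapsto \mathtt{Rl}$, $\mathtt s\mapsto \mathtt{Lr}$, and let $a_n$ be the number of letters of $P_1^n(\mathtt L)$, $n\ge0$ (the length of the right side boundary of the polyomino containing the $n$-th Harter–Heighway dragon iterate). (b) Let $b_n$ ($n\ge1$) be defined by $\frac{x(1+x^2)}{1-x-2x^3}=\sum_{n\ge1}b_nx^n$. (c) Let $c_n$ ($n\ge0$) be the number of binary sequences of length $n$ with no maximal run of zeros of length congruent to $1$ mod $3$ (so $c_0=1$, counting the empty sequence). (d) Let $d_n$ ($n\ge1$) be the number of $n\times 2$ arrays with entries in $\{0,1,2\}$ in which every $1$ has a $0$ immediately above it or immediately to its left, no $0$ has a $0$ immediately above it or immediately to its left, and every $2$ has a $1$ immediately above it and a $0$ directly above that. Then for all $n\ge 0$, $$a_n=b_{n+1}=c_n=d_{n+1}.$$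
   Context: All four sequences begin $1,1,2,4,6,10,\dots$ when indexed so that $a$ and $c$ start at $n=0$ and $b$ and $d$ start at $n=1$. -}

module Defs where

open import Data.Nat using (ℕ; zero; suc; _%_)
open import Data.Nat.Properties using () renaming (_≟_ to _≟ℕ_)
open import Data.Integer using (ℤ; +_; -_) renaming (_+_ to _+ℤ_; _-_ to _-ℤ_; _*_ to _*ℤ_)
open import Data.List using (List; []; _∷_; _++_; concatMap; map; length; filter; zipWith; drop; allFin)
open import Data.List.Relation.Unary.All using (All)
import Data.List.Relation.Unary.All as All
open import Data.Vec using (Vec; toList; lookup) renaming ([] to []ᵥ; _∷_ to _∷ᵥ_)
open import Data.Fin using (Fin; zero; suc)
open import Data.Fin.Properties using (all?) renaming (_≟_ to _≟F_)
open import Data.Maybe using (Maybe; just; nothing)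
open import Data.Maybe.Properties using (≡-dec)
open import Data.Product using (_×_)
open import Data.Sum using (_⊎_)
open import Function using (_∘_)
open import Relation.Nullary using (¬_; Dec)
open import Relation.Nullary.Decidable using (¬?; _×-dec_; _⊎-dec_; _→-dec_)
open import Relation.Binary.PropositionalEquality using (_≡_)

iter : {A : Set} → ℕ → (A → A) → A → A
iter zero    f x = x
iter (suc n) f x = f (iter n f x)

allVec : {A : Set} → List A → (n : ℕ) → List (Vec A n)
allVec xs zero    = []ᵥ ∷ []
allVec xs (suc n) = concatMap (λ x → map (x ∷ᵥ_) (allVec xs n)) xs

data Letter : Set where
  R r L l S s : Letter

P₁-letter : Letter → List Letter
P₁-letter R = R ∷ r ∷ []
P₁-letter r = S ∷ []
P₁-letter L = S ∷ []
P₁-letter l = L ∷ l ∷ []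
P₁-letter S = R ∷ l ∷ []
P₁-letter s = L ∷ r ∷ []

P₁ : List Letter → List Letter
P₁ = concatMap P₁-letter

a : ℕ → ℕ
a n = length (iter n P₁ (L ∷ []))

-- (b) coefficients of a quotient of formal power series N(x)/D(x),
-- N, D polynomials given by coefficient lists (constant term first),
-- with D having constant term 1.  The coefficients q_k are determined by
-- N = D·Q, i.e. q_k = N_k − Σ_{i=1}^{k} D_i q_{k−i}.

coef : List ℤ → ℕ → ℤ
coef []       _       = + 0
coef (x ∷ xs) zero    = x
coef (x ∷ xs) (suc k) = coef xs k

sumℤ : List ℤ → ℤ
sumℤ []       = + 0
sumℤ (x ∷ xs) = x +ℤ sumℤ xs

-- revQuot N D k = [q_{k-1}, …, q_1, q_0]
revQuot : List ℤ → List ℤ → ℕ → List ℤ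
revQuot N D zero    = []
revQuot N D (suc k) =
  (coef N k -ℤ sumℤ (zipWith _*ℤ_ (drop 1 D) (revQuot N D k))) ∷ revQuot N D k

seriesQuotCoeff : List ℤ → List ℤ → ℕ → ℤ
seriesQuotCoeff N D k with revQuot N D (suc k)
... | q ∷ _ = q
... | []    = + 0

b : ℕ → ℤ
b = seriesQuotCoeff (+ 0 ∷ + 1 ∷ + 0 ∷ + 1 ∷ [])
                    (+ 1 ∷ - (+ 1) ∷ + 0 ∷ - (+ 2) ∷ [])

-- lengths of the maximal runs of zeros; first argument = length of the
-- run of zeros currently being read
zeroRunsAux : ℕ → List (Fin 2) → List ℕ
zeroRunsAux zero    []             = []
zeroRunsAux (suc k) []             = suc k ∷ []
zeroRunsAux k       (zero ∷ xs)    = zeroRunsAux (suc k) xs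
zeroRunsAux zero    (suc _ ∷ xs)   = zeroRunsAux zero xs
zeroRunsAux (suc k) (suc _ ∷ xs)   = suc k ∷ zeroRunsAux zero xs

zeroRuns : List (Fin 2) → List ℕ
zeroRuns = zeroRunsAux zero

NoBadRun : {n : ℕ} → Vec (Fin 2) n → Set
NoBadRun v = All (λ m → ¬ (m % 3 ≡ 1)) (zeroRuns (toList v))

noBadRun? : {n : ℕ} (v : Vec (Fin 2) n) → Dec (NoBadRun v)
noBadRun? v = All.all? (λ m → ¬? ((m % 3) ≟ℕ 1)) (zeroRuns (toList v))

c : ℕ → ℕ
c n = length (filter noBadRun? (allVec (allFin 2) n))

-- (d) n×2 arrays over {0,1,2}; row index i (top = 0), column j (left = 0)

Array : ℕ → Set
Array n = Vec (Vec (Fin 3) 2) n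

above : {n : ℕ} → Array n → Fin n → Fin 2 → Maybe (Fin 3)
above A zero    j = nothing
above A (suc i) j = just (lookup (lookup A (Data.Fin.inject₁ i)) j)

above₂ : {n : ℕ} → Array n → Fin n → Fin 2 → Maybe (Fin 3)
above₂ A zero          j = nothing
above₂ A (suc zero)    j = nothing
above₂ A (suc (suc i)) j =
  just (lookup (lookup A (Data.Fin.inject₁ (Data.Fin.inject₁ i))) j)

left : {n : ℕ} → Array n → Fin n → Fin 2 → Maybe (Fin 3)
left A i zero    = nothing
left A i (suc j) = just (lookup (lookup A i) (Data.Fin.inject₁ j))

e0 e1 e2 : Fin 3
e0 = zero
e1 = suc zero
e2 = suc (suc zero)

CellOK : {n : ℕ} → Array n → Fin n → Fin 2 → Set
CellOK A i j =
  (lookup (lookup A i) j ≡ e1 → (above A i j ≡ just e0) ⊎ (left A i j ≡ just e0)) ×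
  (lookup (lookup A i) j ≡ e0 → ¬ (above A i j ≡ just e0) × ¬ (left A i j ≡ just e0)) ×
  (lookup (lookup A i) j ≡ e2 → (above A i j ≡ just e1) × (above₂ A i j ≡ just e0))

cellOK? : {n : ℕ} (A : Array n) (i : Fin n) (j : Fin 2) → Dec (CellOK A i j)
cellOK? A i j =
  ((lookup (lookup A i) j ≟F e1) →-dec
     (≡-dec _≟F_ (above A i j) (just e0) ⊎-dec ≡-dec _≟F_ (left A i j) (just e0))) ×-dec
  ((lookup (lookup A i) j ≟F e0) →-dec
     (¬? (≡-dec _≟F_ (above A i j) (just e0)) ×-dec ¬? (≡-dec _≟F_ (left A i j) (just e0)))) ×-dec
  ((lookup (lookup A i) j ≟F e2) →-dec
     (≡-dec _≟F_ (above A i j) (just e1) ×-dec ≡-dec _≟F_ (above₂ A i j) (just e0)))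

Valid : {n : ℕ} → Array n → Set
Valid A = ∀ i j → CellOK A i j

valid? : {n : ℕ} (A : Array n) → Dec (Valid A)
valid? A = all? (λ i → all? (λ j → cellOK? A i j))

d : ℕ → ℕ
d n = length (filter valid? (allVec (allVec (allFin 3) 2) n))

-- All four sequences satisfy xₙ₊₃ = xₙ₊₂ + 2xₙ with initial values 1, 1, 2, hence
-- coincide. For (a), |P₁ⁿ(x)| obeys linear recurrences in the letters, and the mirror
-- symmetry R ↔ l, r ↔ L (with S, s fixed, followed by reversal) commutes with P₁.
-- For (b) it is the coefficient recurrence of the rational series. For (c) and (d)
-- it comes from a transfer matrix: in (c) the state is the length of the pending
-- zero run, which matters only modulo 3; in (d) it is the last two rows, and merging
-- states with the same counts leaves four of them.
module Submission where

open import Defs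
open import Data.Nat using (ℕ; zero; suc; _+_; _*_; _%_)
open import Data.Nat.Properties using (+-comm; +-identityʳ) renaming (_≟_ to _≟ℕ_)
import Data.Nat.Tactic.RingSolver as ℕ-Solver
open import Data.Nat.ListAction using (sum)
open import Data.Integer using (ℤ; +_; -[1+_]) renaming (_+_ to _+ℤ_; _-_ to _-ℤ_; _*_ to _*ℤ_)
open import Data.Integer.Properties using (pos-+; pos-*)
import Data.Integer.Tactic.RingSolver as ℤ-Solver
open import Data.List using (List; []; _∷_; _++_; map; concatMap; length; filter; allFin)
open import Data.List.Properties using (length-++; filter-++; filter-≐; filter-none; map-cong; concatMap-++)
open import Data.List.Relation.Unary.All using (_∷_; uncons; universal)
import Data.List.Relation.Unary.All as All
open import Data.Vec using (Vec; toList; lookup) renaming ([] to []ᵥ; _∷_ to _∷ᵥ_)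
open import Data.Fin using (Fin; zero; suc)
open import Data.Fin.Properties using (all?) renaming (_≟_ to _≟F_)
open import Data.Maybe using (Maybe; just; nothing)
import Data.Maybe as Maybe
open import Data.Maybe.Properties using (≡-dec)
open import Data.Sum using (_⊎_)
open import Data.Product using (_×_; _,_; proj₁; proj₂; uncurry)
open import Function using (_∘_)
open import Relation.Nullary using (¬_; Dec; yes; no)
open import Relation.Nullary.Decidable using (¬?; _×-dec_; _⊎-dec_; _→-dec_)
open import Relation.Unary using (Pred; Decidable; _≐_)
open import Relation.Binary.PropositionalEquality
  using (_≡_; _≗_; refl; sym; trans; cong; cong₂; module ≡-Reasoning)

module _ {A : Set} (step : A → A → A → A) where

  ThirdOrder : (ℕ → A) → Set
  ThirdOrder g = ∀ n → g (3 + n) ≡ step (g n) (g (1 + n)) (g (2 + n))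

  thirdOrder-unique : ∀ {g h} → ThirdOrder g → ThirdOrder h →
                      g 0 ≡ h 0 → g 1 ≡ h 1 → g 2 ≡ h 2 → g ≗ h
  thirdOrder-unique {g} {h} rg rh e₀ e₁ e₂ n = proj₁ (agree n)
    where
    agree : ∀ n → g n ≡ h n × g (1 + n) ≡ h (1 + n) × g (2 + n) ≡ h (2 + n)
    agree zero = e₀ , e₁ , e₂
    agree (suc n) =
      let eₙ , eₙ₊₁ , eₙ₊₂ = agree n in
      eₙ₊₁ , eₙ₊₂ , (begin
      g (3 + n)                           ≡⟨ rg n ⟩
      step (g n) (g (1 + n)) (g (2 + n))  ≡⟨ cong₂ (λ x z → step x (g (1 + n)) z) eₙ eₙ₊₂ ⟩
      step (h n) (g (1 + n)) (h (2 + n))  ≡⟨ cong (λ y → step (h n) y (h (2 + n))) eₙ₊₁ ⟩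
      step (h n) (h (1 + n)) (h (2 + n))  ≡⟨ rh n ⟨
      h (3 + n)                           ∎)
      where open ≡-Reasoning

rule : ℕ → ℕ → ℕ → ℕ
rule xₙ _ xₙ₊₂ = xₙ₊₂ + 2 * xₙ

ruleℤ : ℤ → ℤ → ℤ → ℤ
ruleℤ xₙ _ xₙ₊₂ = xₙ₊₂ +ℤ + 2 *ℤ xₙ

Recurrence : (ℕ → ℕ) → Set
Recurrence = ThirdOrder rule

Recurrenceℤ : (ℕ → ℤ) → Set
Recurrenceℤ = ThirdOrder ruleℤ

recurrence⇒recurrenceℤ : ∀ {g} → Recurrence g → Recurrenceℤ (+_ ∘ g)
recurrence⇒recurrenceℤ {g} rg n = begin
  + g (3 + n)                          ≡⟨ cong +_ (rg n) ⟩
  + (g (2 + n) + 2 * g n)              ≡⟨ pos-+ (g (2 + n)) (2 * g n) ⟩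
  + g (2 + n) +ℤ + (2 * g n)           ≡⟨ cong (+ g (2 + n) +ℤ_) (pos-* 2 (g n)) ⟩
  + g (2 + n) +ℤ + 2 *ℤ + g n          ∎
  where open ≡-Reasoning

count : ∀ {p} {A : Set} {P : Pred A p} → Decidable P → List A → ℕ
count P? = length ∘ filter P?

module _ {p} {A : Set} {P : Pred A p} (P? : Decidable P) where

  count-++ : ∀ xs ys → count P? (xs ++ ys) ≡ count P? xs + count P? ys
  count-++ xs ys = trans (cong length (filter-++ P? xs ys)) (length-++ (filter P? xs))

  count-concatMap : ∀ {B : Set} (f : B → List A) ys →
                    count P? (concatMap f ys) ≡ sum (map (count P? ∘ f) ys)
  count-concatMap f [] = refl
  count-concatMap f (y ∷ ys) =
    trans (count-++ (f y) (concatMap f ys)) (cong (_+_ (count P? (f y))) (count-concatMap f ys))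

  count-map : ∀ {B : Set} (f : B → A) xs → count P? (map f xs) ≡ count (P? ∘ f) xs
  count-map f [] = refl
  count-map f (x ∷ xs) with P? (f x)
  ... | yes _ = cong suc (count-map f xs)
  ... | no _  = count-map f xs

count-≐ : ∀ {p q} {A : Set} {P : Pred A p} {Q : Pred A q} (P? : Decidable P) (Q? : Decidable Q) →
          P ≐ Q → count P? ≗ count Q?
count-≐ P? Q? P≐Q = cong length ∘ filter-≐ P? Q? P≐Q

keepIf : ∀ {q} {Q : Set q} → Dec Q → ℕ → ℕ
keepIf (yes _) m = m
keepIf (no _)  _ = 0

count-guard : ∀ {p q} {A : Set} {P : Pred A p} {Q : Set q} (Q? : Dec Q) (P? : Decidable P) xs →
              count (λ x → Q? ×-dec P? x) xs ≡ keepIf Q? (count P? xs)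
count-guard (yes q) P? xs = count-≐ _ P? (proj₂ , (q ,_)) xs
count-guard (no ¬q) P? xs = cong length (filter-none _ (universal (λ _ → ¬q ∘ proj₁) xs))

count-allVec-suc : ∀ {p} {A : Set} (xs : List A) n {P : Pred (Vec A (suc n)) p} (P? : Decidable P) →
                   count P? (allVec xs (suc n)) ≡ sum (map (λ x → count (P? ∘ (x ∷ᵥ_)) (allVec xs n)) xs)
count-allVec-suc xs n P? =
  trans (count-concatMap P? (λ x → map (x ∷ᵥ_) (allVec xs n)) xs)
        (cong sum (map-cong (λ x → count-map P? (x ∷ᵥ_) (allVec xs n)) xs))

iter-suc′ : ∀ {A : Set} (f : A → A) n x → iter (suc n) f x ≡ iter n f (f x)
iter-suc′ f zero    x = refl
iter-suc′ f (suc n) x = cong f (iter-suc′ f n x)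

iter-++-hom : ∀ {A : Set} (f : List A → List A) → (∀ xs ys → f (xs ++ ys) ≡ f xs ++ f ys) →
              ∀ n xs ys → iter n f (xs ++ ys) ≡ iter n f xs ++ iter n f ys
iter-++-hom f f-hom zero    xs ys = refl
iter-++-hom f f-hom (suc n) xs ys = trans (cong f (iter-++-hom f f-hom n xs ys)) (f-hom _ _)

size : ℕ → Letter → ℕ
size n x = length (iter n P₁ (x ∷ []))

size-pair : ∀ n x y → length (iter n P₁ (x ∷ y ∷ [])) ≡ size n x + size n y
size-pair n x y =
  trans (cong length (iter-++-hom P₁ (concatMap-++ P₁-letter) n (x ∷ []) (y ∷ [])))
        (length-++ (iter n P₁ (x ∷ [])))

size-suc : ∀ n x → size (suc n) x ≡ length (iter n P₁ (P₁ (x ∷ [])))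
size-suc n x = cong length (iter-suc′ P₁ n (x ∷ []))

size-L : ∀ n → size (suc n) L ≡ size n S
size-L n = size-suc n L

size-r : ∀ n → size (suc n) r ≡ size n S
size-r n = size-suc n r

size-R : ∀ n → size (suc n) R ≡ size n R + size n r
size-R n = trans (size-suc n R) (size-pair n R r)

size-l : ∀ n → size (suc n) l ≡ size n L + size n l
size-l n = trans (size-suc n l) (size-pair n L l)

size-S : ∀ n → size (suc n) S ≡ size n R + size n l
size-S n = trans (size-suc n S) (size-pair n R l)

size-mirror : ∀ n → size n R ≡ size n l × size n r ≡ size n L
size-mirror zero = refl , refl
size-mirror (suc n) =
  let R≡l , r≡L = size-mirror n in
  (begin
    size (suc n) R        ≡⟨ size-R n ⟩
    size n R + size n r   ≡⟨ cong₂ _+_ R≡l r≡L ⟩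
    size n l + size n L   ≡⟨ +-comm (size n l) (size n L) ⟩
    size n L + size n l   ≡⟨ size-l n ⟨
    size (suc n) l        ∎) ,
  trans (size-r n) (sym (size-L n))
  where open ≡-Reasoning

a-recurrence : Recurrence a
a-recurrence n = begin
  size (3 + n) L                                        ≡⟨ size-L (2 + n) ⟩
  size (2 + n) S                                        ≡⟨ size-S (1 + n) ⟩
  size (1 + n) R + size (1 + n) l                       ≡⟨ cong (_+ size (1 + n) l) (proj₁ (size-mirror (1 + n))) ⟩
  size (1 + n) l + size (1 + n) l                       ≡⟨ cong₂ _+_ (size-l n) (size-l n) ⟩
  (size n L + size n l) + (size n L + size n l)         ≡⟨ double-sum (size n L) (size n l) ⟩
  (size n l + size n l) + 2 * size n L                  ≡⟨ cong (λ x → (x + size n l) + 2 * size n L) (proj₁ (size-mirror n)) ⟨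
  (size n R + size n l) + 2 * size n L                  ≡⟨ cong (_+ 2 * size n L) (size-S n) ⟨
  size (1 + n) S + 2 * size n L                         ≡⟨ cong (_+ 2 * size n L) (size-L (1 + n)) ⟨
  size (2 + n) L + 2 * size n L                         ∎
  where
  open ≡-Reasoning
  double-sum : ∀ x y → (x + y) + (x + y) ≡ (y + y) + 2 * x
  double-sum = ℕ-Solver.solve-∀

-- Past the degree of the numerator, N = D·Q with D = 1 − x − 2x³ reads
-- qₖ = qₖ₋₁ + 2qₖ₋₃; the left side of quotient-step is revQuot's unfolding of it.
b-recurrence : Recurrenceℤ (b ∘ suc)
b-recurrence n = quotient-step (b (3 + n)) (b (2 + n)) (b (1 + n))
  where
  quotient-step : ∀ z y x → + 0 -ℤ (-[1+ 0 ] *ℤ z +ℤ (+ 0 *ℤ y +ℤ (-[1+ 1 ] *ℤ x +ℤ + 0)))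
                            ≡ z +ℤ + 2 *ℤ x
  quotient-step = ℤ-Solver.solve-∀

count-All-∷ : ∀ {p} {A : Set} {P : Pred ℕ p} (P? : Decidable P) m (f : A → List ℕ) xs →
              count (λ x → All.all? P? (m ∷ f x)) xs ≡ keepIf (P? m) (count (λ x → All.all? P? (f x)) xs)
count-All-∷ P? m f xs =
  trans (count-≐ _ _ (uncons , uncurry _∷_) xs) (count-guard (P? m) (λ x → All.all? P? (f x)) xs)

goodRun? : (m : ℕ) → Dec (¬ m % 3 ≡ 1)
goodRun? m = ¬? ((m % 3) ≟ℕ 1)

-- counts the words w of length n such that no maximal zero run of 0ᵏw has length ≡ 1 (mod 3)
countAfterRun : ℕ → ℕ → ℕ
countAfterRun k n = count (λ v → All.all? goodRun? (zeroRunsAux k (toList v))) (allVec (allFin 2) n)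

countAfterRun-zero-suc : ∀ n → countAfterRun 0 (suc n) ≡ countAfterRun 1 n + (countAfterRun 0 n + 0)
countAfterRun-zero-suc n = count-allVec-suc (allFin 2) n _

countAfterRun-suc-suc : ∀ k n → countAfterRun (suc k) (suc n)
                        ≡ countAfterRun (2 + k) n + (keepIf (goodRun? (suc k)) (countAfterRun 0 n) + 0)
countAfterRun-suc-suc k n =
  trans (count-allVec-suc (allFin 2) n _)
        (cong (λ m → countAfterRun (2 + k) n + (m + 0))
              (count-All-∷ goodRun? (suc k) (zeroRuns ∘ toList) (allVec (allFin 2) n)))

countAfterRun-suc-zero : ∀ k → countAfterRun (suc k) 0 ≡ keepIf (goodRun? (suc k)) 1
countAfterRun-suc-zero k =
  trans (count-≐ (λ v → All.all? goodRun? (zeroRunsAux (suc k) (toList v)))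
                 (λ _ → All.all? goodRun? (suc k ∷ []))
                 ((λ { {[]ᵥ} p → p }) , (λ { {[]ᵥ} p → p })) (allVec (allFin 2) 0))
        (count-All-∷ goodRun? (suc k) (λ _ → []) (allVec (allFin 2) 0))

-- (3 + m) % 3 and m % 3 are definitionally equal, so the guards on both sides agree.
countAfterRun-periodic : ∀ k n → countAfterRun (3 + suc k) n ≡ countAfterRun (suc k) n
countAfterRun-periodic k zero =
  trans (countAfterRun-suc-zero (3 + k)) (sym (countAfterRun-suc-zero k))
countAfterRun-periodic k (suc n) =
  trans (countAfterRun-suc-suc (3 + k) n)
        (trans (cong (λ m → m + (keepIf (goodRun? (suc k)) (countAfterRun 0 n) + 0)) (countAfterRun-periodic (suc k) n))
               (sym (countAfterRun-suc-suc k n)))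

countAfterRun-three : ∀ n → countAfterRun 3 n ≡ countAfterRun 0 n
countAfterRun-three zero = refl
countAfterRun-three (suc n) =
  trans (countAfterRun-suc-suc 2 n)
        (trans (cong (λ m → m + (countAfterRun 0 n + 0)) (countAfterRun-periodic 0 n))
               (sym (countAfterRun-zero-suc n)))

c-recurrence : Recurrence c
c-recurrence n = begin
  countAfterRun 0 (3 + n)                                       ≡⟨ countAfterRun-zero-suc (2 + n) ⟩
  countAfterRun 1 (2 + n) + (countAfterRun 0 (2 + n) + 0)       ≡⟨ +-comm (countAfterRun 1 (2 + n)) _ ⟩
  (countAfterRun 0 (2 + n) + 0) + countAfterRun 1 (2 + n)       ≡⟨ cong₂ _+_ (+-identityʳ _) pending-one ⟩
  countAfterRun 0 (2 + n) + 2 * countAfterRun 0 n               ∎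
  where
  open ≡-Reasoning
  pending-one : countAfterRun 1 (2 + n) ≡ 2 * countAfterRun 0 n
  pending-one = begin
    countAfterRun 1 (2 + n)                                     ≡⟨ countAfterRun-suc-suc 0 (1 + n) ⟩
    countAfterRun 2 (1 + n) + 0                                 ≡⟨ +-identityʳ _ ⟩
    countAfterRun 2 (1 + n)                                     ≡⟨ countAfterRun-suc-suc 1 n ⟩
    countAfterRun 3 n + (countAfterRun 0 n + 0)                 ≡⟨ cong (_+ (countAfterRun 0 n + 0)) (countAfterRun-three n) ⟩
    2 * countAfterRun 0 n                                       ∎

Row : Set
Row = Vec (Fin 3) 2

rows : List Row
rows = allVec (allFin 3) 2

CellRule : Fin 3 → (up up₂ lt : Maybe (Fin 3)) → Set
CellRule x up up₂ lt =
  (x ≡ e1 → (up ≡ just e0) ⊎ (lt ≡ just e0)) ×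
  (x ≡ e0 → ¬ (up ≡ just e0) × ¬ (lt ≡ just e0)) ×
  (x ≡ e2 → (up ≡ just e1) × (up₂ ≡ just e0))

cellRule? : ∀ x up up₂ lt → Dec (CellRule x up up₂ lt)
cellRule? x up up₂ lt =
  ((x ≟F e1) →-dec (≡-dec _≟F_ up (just e0) ⊎-dec ≡-dec _≟F_ lt (just e0))) ×-dec
  ((x ≟F e0) →-dec (¬? (≡-dec _≟F_ up (just e0)) ×-dec ¬? (≡-dec _≟F_ lt (just e0)))) ×-dec
  ((x ≟F e2) →-dec (≡-dec _≟F_ up (just e1) ×-dec ≡-dec _≟F_ up₂ (just e0)))

column : Fin 2 → Maybe Row → Maybe (Fin 3)
column j = Maybe.map (λ x → lookup x j)

-- entries above a cell of A when A is stacked under the rows p₁ (directly above A) and p₂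
aboveIn : Maybe Row → {n : ℕ} → Array n → Fin n → Fin 2 → Maybe (Fin 3)
aboveIn p₁ A zero    j = column j p₁
aboveIn p₁ A (suc i) j = above A (suc i) j

above₂In : Maybe Row → Maybe Row → {n : ℕ} → Array n → Fin n → Fin 2 → Maybe (Fin 3)
above₂In p₁ p₂ A zero          j = column j p₂
above₂In p₁ p₂ A (suc zero)    j = column j p₁
above₂In p₁ p₂ A (suc (suc i)) j = above₂ A (suc (suc i)) j

ValidUnder : Maybe Row → Maybe Row → {n : ℕ} → Array n → Set
ValidUnder p₁ p₂ A = ∀ i j →
  CellRule (lookup (lookup A i) j) (aboveIn p₁ A i j) (above₂In p₁ p₂ A i j) (left A i j)

validUnder? : ∀ p₁ p₂ {n} (A : Array n) → Dec (ValidUnder p₁ p₂ A)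
validUnder? p₁ p₂ A = all? (λ i → all? (λ j → cellRule? _ _ _ _))

RowUnder : Maybe Row → Maybe Row → Row → Set
RowUnder p₁ p₂ x =
  CellRule (lookup x zero) (column zero p₁) (column zero p₂) nothing ×
  CellRule (lookup x (suc zero)) (column (suc zero) p₁) (column (suc zero) p₂) (just (lookup x zero))

rowUnder? : ∀ p₁ p₂ x → Dec (RowUnder p₁ p₂ x)
rowUnder? p₁ p₂ x = cellRule? _ _ _ _ ×-dec cellRule? _ _ _ _

valid≐validUnder : ∀ {n} → Valid {n} ≐ ValidUnder nothing nothing
valid≐validUnder = to , from
  where
  to : ∀ {n} {A : Array n} → Valid A → ValidUnder nothing nothing A
  to V zero          j = V zero j
  to V (suc zero)    j = V (suc zero) j
  to V (suc (suc i)) j = V (suc (suc i)) j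
  from : ∀ {n} {A : Array n} → ValidUnder nothing nothing A → Valid A
  from V zero          j = V zero j
  from V (suc zero)    j = V (suc zero) j
  from V (suc (suc i)) j = V (suc (suc i)) j

validUnder-∷ : ∀ p₁ p₂ {n} x →
  (λ (A : Array n) → ValidUnder p₁ p₂ (x ∷ᵥ A)) ≐ (λ A → RowUnder p₁ p₂ x × ValidUnder (just x) p₁ A)
validUnder-∷ p₁ p₂ x = (λ V → (V zero zero , V zero (suc zero)) , rest V) , uncurry join
  where
  rest : ∀ {n} {A : Array n} → ValidUnder p₁ p₂ (x ∷ᵥ A) → ValidUnder (just x) p₁ A
  rest V zero          zero    = V (suc zero) zero
  rest V zero          (suc j) = V (suc zero) (suc j)
  rest V (suc zero)    zero    = V (suc (suc zero)) zero
  rest V (suc zero)    (suc j) = V (suc (suc zero)) (suc j)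
  rest V (suc (suc i)) zero    = V (suc (suc (suc i))) zero
  rest V (suc (suc i)) (suc j) = V (suc (suc (suc i))) (suc j)
  join : ∀ {n} {A : Array n} → RowUnder p₁ p₂ x → ValidUnder (just x) p₁ A → ValidUnder p₁ p₂ (x ∷ᵥ A)
  join (ok₀ , ok₁) V zero       zero          = ok₀
  join (ok₀ , ok₁) V zero       (suc zero)    = ok₁
  join _ V (suc zero)          zero    = V zero zero
  join _ V (suc zero)          (suc j) = V zero (suc j)
  join _ V (suc (suc zero))    zero    = V (suc zero) zero
  join _ V (suc (suc zero))    (suc j) = V (suc zero) (suc j)
  join _ V (suc (suc (suc i))) zero    = V (suc (suc i)) zero
  join _ V (suc (suc (suc i))) (suc j) = V (suc (suc i)) (suc j)

countUnder : Maybe Row → Maybe Row → ℕ → ℕ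
countUnder p₁ p₂ n = count (validUnder? p₁ p₂) (allVec rows n)

countUnder-suc : ∀ p₁ p₂ n →
  countUnder p₁ p₂ (suc n) ≡ sum (map (λ x → keepIf (rowUnder? p₁ p₂ x) (countUnder (just x) p₁ n)) rows)
countUnder-suc p₁ p₂ n =
  trans (count-allVec-suc rows n (validUnder? p₁ p₂))
        (cong sum (map-cong (λ x → trans (count-≐ (validUnder? p₁ p₂ ∘ (x ∷ᵥ_)) _ (validUnder-∷ p₁ p₂ x) (allVec rows n))
                                         (count-guard (rowUnder? p₁ p₂ x) (validUnder? (just x) p₁) (allVec rows n)))
                            rows))

-- N p q n counts the arrays of height n that may be stacked under the row p, itself
-- under q. Each transition below is countUnder-suc evaluated: only the rows shown on
-- the right satisfy RowUnder.
N : Row → Row → ℕ → ℕ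
N p q = countUnder (just p) (just q)

r₀₁ r₁₀ r₂₁ r₀₂ r₁₂ r₂₀ : Row
r₀₁ = e0 ∷ᵥ e1 ∷ᵥ []ᵥ
r₁₀ = e1 ∷ᵥ e0 ∷ᵥ []ᵥ
r₂₁ = e2 ∷ᵥ e1 ∷ᵥ []ᵥ
r₀₂ = e0 ∷ᵥ e2 ∷ᵥ []ᵥ
r₁₂ = e1 ∷ᵥ e2 ∷ᵥ []ᵥ
r₂₀ = e2 ∷ᵥ e0 ∷ᵥ []ᵥ

N-10-01-suc : ∀ n → N r₁₀ r₀₁ (suc n) ≡ N r₀₁ r₁₀ n + (N r₂₁ r₁₀ n + 0)
N-10-01-suc = countUnder-suc _ _
N-01-10-suc : ∀ n → N r₀₁ r₁₀ (suc n) ≡ N r₁₀ r₀₁ n + (N r₁₂ r₀₁ n + 0)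
N-01-10-suc = countUnder-suc _ _
N-21-10-suc : ∀ n → N r₂₁ r₁₀ (suc n) ≡ N r₀₁ r₂₁ n + (N r₀₂ r₂₁ n + 0)
N-21-10-suc = countUnder-suc _ _
N-01-21-suc : ∀ n → N r₀₁ r₂₁ (suc n) ≡ N r₁₀ r₀₁ n + 0
N-01-21-suc = countUnder-suc _ _
N-02-21-suc : ∀ n → N r₀₂ r₂₁ (suc n) ≡ N r₁₀ r₀₂ n + 0
N-02-21-suc = countUnder-suc _ _
N-10-02-suc : ∀ n → N r₁₀ r₀₂ (suc n) ≡ N r₀₁ r₁₀ n + (N r₂₁ r₁₀ n + 0)
N-10-02-suc = countUnder-suc _ _
N-12-01-suc : ∀ n → N r₁₂ r₀₁ (suc n) ≡ N r₀₁ r₁₂ n + (N r₂₀ r₁₂ n + 0)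
N-12-01-suc = countUnder-suc _ _
N-01-12-suc : ∀ n → N r₀₁ r₁₂ (suc n) ≡ N r₁₀ r₀₁ n + 0
N-01-12-suc = countUnder-suc _ _
N-20-12-suc : ∀ n → N r₂₀ r₁₂ (suc n) ≡ N r₀₁ r₂₀ n + 0
N-20-12-suc = countUnder-suc _ _
N-01-20-suc : ∀ n → N r₀₁ r₂₀ (suc n) ≡ N r₁₀ r₀₁ n + (N r₁₂ r₀₁ n + 0)
N-01-20-suc = countUnder-suc _ _

N-10-02≗N-10-01 : N r₁₀ r₀₂ ≗ N r₁₀ r₀₁
N-10-02≗N-10-01 zero    = refl
N-10-02≗N-10-01 (suc n) = trans (N-10-02-suc n) (sym (N-10-01-suc n))

N-01-20≗N-01-10 : N r₀₁ r₂₀ ≗ N r₀₁ r₁₀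
N-01-20≗N-01-10 zero    = refl
N-01-20≗N-01-10 (suc n) = trans (N-01-20-suc n) (sym (N-01-10-suc n))

N-01-12≗N-01-21 : N r₀₁ r₁₂ ≗ N r₀₁ r₂₁
N-01-12≗N-01-21 zero    = refl
N-01-12≗N-01-21 (suc n) = trans (N-01-12-suc n) (sym (N-01-21-suc n))

N-bisimilar : ∀ n → N r₁₀ r₀₁ n ≡ N r₀₁ r₁₀ n × N r₁₂ r₀₁ n ≡ N r₂₁ r₁₀ n × N r₂₀ r₁₂ n ≡ N r₀₂ r₂₁ n
N-bisimilar zero = refl , refl , refl
N-bisimilar (suc n) =
  let ih₁ , ih₂ , ih₃ = N-bisimilar n in
  trans (N-10-01-suc n) (trans (cong₂ (λ u v → u + (v + 0)) (sym ih₁) (sym ih₂)) (sym (N-01-10-suc n))) ,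
  trans (N-12-01-suc n) (trans (cong₂ (λ u v → u + (v + 0)) (N-01-12≗N-01-21 n) ih₃) (sym (N-21-10-suc n))) ,
  trans (N-20-12-suc n)
        (trans (cong (_+ 0) (trans (N-01-20≗N-01-10 n) (trans (sym ih₁) (sym (N-10-02≗N-10-01 n)))))
               (sym (N-02-21-suc n)))

N-21-10-twice : ∀ n → N r₂₁ r₁₀ (2 + n) ≡ 2 * N r₁₀ r₀₁ n
N-21-10-twice n =
  trans (N-21-10-suc (1 + n))
        (cong₂ (λ u v → u + (v + 0))
               (trans (N-01-21-suc n) (+-identityʳ _))
               (trans (N-02-21-suc n) (trans (+-identityʳ _) (N-10-02≗N-10-01 n))))

N-10-01-recurrence : Recurrence (N r₁₀ r₀₁)
N-10-01-recurrence n = begin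
  N r₁₀ r₀₁ (3 + n)                              ≡⟨ N-10-01-suc (2 + n) ⟩
  N r₀₁ r₁₀ (2 + n) + (N r₂₁ r₁₀ (2 + n) + 0)    ≡⟨ cong₂ (λ u v → u + (v + 0)) (sym (proj₁ (N-bisimilar (2 + n)))) (N-21-10-twice n) ⟩
  N r₁₀ r₀₁ (2 + n) + (2 * N r₁₀ r₀₁ n + 0)      ≡⟨ cong (_+_ (N r₁₀ r₀₁ (2 + n))) (+-identityʳ _) ⟩
  N r₁₀ r₀₁ (2 + n) + 2 * N r₁₀ r₀₁ n            ∎
  where open ≡-Reasoning

d-suc-suc : ∀ n → d (2 + n) ≡ N r₁₀ r₀₁ n
d-suc-suc n = begin
  d (2 + n)                                        ≡⟨ count-≐ valid? (validUnder? nothing nothing) valid≐validUnder (allVec rows (2 + n)) ⟩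
  countUnder nothing nothing (2 + n)               ≡⟨ countUnder-suc nothing nothing (1 + n) ⟩
  countUnder (just r₀₁) nothing (1 + n) + 0        ≡⟨ +-identityʳ _ ⟩
  countUnder (just r₀₁) nothing (1 + n)            ≡⟨ countUnder-suc (just r₀₁) nothing n ⟩
  N r₁₀ r₀₁ n + 0                                  ≡⟨ +-identityʳ _ ⟩
  N r₁₀ r₀₁ n                                      ∎
  where open ≡-Reasoning

d-recurrence : Recurrence (d ∘ suc)
d-recurrence zero = d-suc-suc 2    -- N r₁₀ r₀₁ 2 evaluates to 4
d-recurrence (suc n) = begin
  d (5 + n)                                        ≡⟨ d-suc-suc (3 + n) ⟩
  N r₁₀ r₀₁ (3 + n)                                ≡⟨ N-10-01-recurrence n ⟩
  N r₁₀ r₀₁ (2 + n) + 2 * N r₁₀ r₀₁ n              ≡⟨ cong₂ (λ u v → u + 2 * v) (d-suc-suc (2 + n)) (d-suc-suc n) ⟨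
  d (4 + n) + 2 * d (2 + n)                        ∎
  where open ≡-Reasoning

a≗b∘suc : +_ ∘ a ≗ b ∘ suc
a≗b∘suc = thirdOrder-unique ruleℤ (recurrence⇒recurrenceℤ {a} a-recurrence) b-recurrence refl refl refl

a≗c : a ≗ c
a≗c = thirdOrder-unique rule a-recurrence c-recurrence refl refl refl

c≗d∘suc : c ≗ d ∘ suc
c≗d∘suc = thirdOrder-unique rule c-recurrence d-recurrence refl refl refl

corollary1 : ∀ (n : ℕ) →
    (+ (a n) ≡ b (suc n)) × (a n ≡ c n) × (c n ≡ d (suc n))
corollary1 n = a≗b∘suc n , a≗c n , c≗d∘suc n
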